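{- Let $G$ be a $C_4$-pivotable graph on $n$ vertices. Then $G$ has minimum degree at least $2$ and maximum degree at most $n-2$.
   Context: A simple graph $G$ on $n$ vertices with exactly $2n-4$ edges is $C_4$-pivotable if $G$ contains an induced cycle $C$ of length 4 (the central cycle) and two spanning trees whose edge sets have exactly two common edges, both of which are edges of $C$. -}

module Defs where

open import Data.Nat using (ℕ; suc; _<_; _≤_)
open import Data.Fin as Fin using (Fin; toℕ)
open import Data.Product using (Σ; _×_; _,_; proj₁; proj₂)
open import Data.Sum using (_⊎_)
open import Data.List using (List; []; _∷_; length; filter)
open import Data.List.Membership.Propositional using (_∈_)
open import Data.List.Relation.Unary.All using (All)
open import Data.List.Relation.Unary.Unique.Propositional using (Unique)
open import Relation.Binary.PropositionalEquality using (_≡_; _≢_)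
open import Relation.Nullary using (¬_)
open import Relation.Nullary.Decidable using (_⊎-dec_)

-- An edge on vertex set Fin n is stored as an ordered pair (i , j) with i < j,
-- so each unordered pair {i , j} has exactly one representation.
Edge : ℕ → Set
Edge n = Fin n × Fin n

Normalised : ∀ {n} → Edge n → Set
Normalised (i , j) = toℕ i < toℕ j

record EdgeSet (n : ℕ) : Set where
  field
    edges      : List (Edge n)
    normalised : All Normalised edges
    unique     : Unique edges
open EdgeSet public

Graph : ℕ → Set
Graph = EdgeSet

numEdges : ∀ {n} → EdgeSet n → ℕ
numEdges F = length (edges F)

Adj : ∀ {n} → EdgeSet n → Fin n → Fin n → Set
Adj F u v = ((u , v) ∈ edges F) ⊎ ((v , u) ∈ edges F)

degree : ∀ {n} → Graph n → Fin n → ℕ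
degree G v = length (filter (λ e → (proj₁ e Fin.≟ v) ⊎-dec (proj₂ e Fin.≟ v)) (edges G))

_⊆E_ : ∀ {n} → EdgeSet n → EdgeSet n → Set
F ⊆E G = ∀ {e} → e ∈ edges F → e ∈ edges G

data Walk {n} (F : EdgeSet n) : Fin n → Fin n → Set where
  here : ∀ {u} → Walk F u u
  step : ∀ {u v w} → Adj F u v → Walk F v w → Walk F u w

Connected : ∀ {n} → EdgeSet n → Set
Connected {n} F = (u v : Fin n) → Walk F u v

data PathList {n} (F : EdgeSet n) : List (Fin n) → Set where
  one  : ∀ {v} → PathList F (v ∷ [])
  cons : ∀ {u v vs} → Adj F u v → PathList F (v ∷ vs) → PathList F (u ∷ v ∷ vs)

record Cycle {n} (F : EdgeSet n) : Set where
  field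
    first  : Fin n
    rest   : List (Fin n)
    last   : Fin n
    long   : 1 ≤ length rest
    path   : PathList F (first ∷ rest Data.List.++ (last ∷ []))
    distinct : Unique (first ∷ rest Data.List.++ (last ∷ []))
    closes : Adj F last first

Acyclic : ∀ {n} → EdgeSet n → Set
Acyclic F = ¬ Cycle F

IsTree : ∀ {n} → EdgeSet n → Set
IsTree F = Connected F × Acyclic F

SpanningTree : ∀ {n} → Graph n → EdgeSet n → Set
SpanningTree G T = (T ⊆E G) × IsTree T

Joins : ∀ {n} → Edge n → Fin n → Fin n → Set
Joins e x y = (proj₁ e ≡ x × proj₂ e ≡ y) ⊎ (proj₁ e ≡ y × proj₂ e ≡ x)

record InducedC4 {n} (G : Graph n) (a b c d : Fin n) : Set where
  field
    a≢b : a ≢ b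
    a≢c : a ≢ c
    a≢d : a ≢ d
    b≢c : b ≢ c
    b≢d : b ≢ d
    c≢d : c ≢ d
    ab : Adj G a b
    bc : Adj G b c
    cd : Adj G c d
    da : Adj G d a
    ¬ac : ¬ Adj G a c
    ¬bd : ¬ Adj G b d

EdgeOfC4 : ∀ {n} → Fin n → Fin n → Fin n → Fin n → Edge n → Set
EdgeOfC4 a b c d e = Joins e a b ⊎ Joins e b c ⊎ Joins e c d ⊎ Joins e d a

record C4Pivotable {n} (G : Graph n) : Set where
  field
    edgeCount : numEdges G ≡ 2 Data.Nat.* n Data.Nat.∸ 4
    a b c d : Fin n
    central : InducedC4 G a b c d
    T₁ T₂ : EdgeSet n
    span₁ : SpanningTree G T₁
    span₂ : SpanningTree G T₂
    e₁ e₂ : Edge n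
    e₁≢e₂ : e₁ ≢ e₂
    e₁∈T₁ : e₁ ∈ edges T₁
    e₁∈T₂ : e₁ ∈ edges T₂
    e₂∈T₁ : e₂ ∈ edges T₁
    e₂∈T₂ : e₂ ∈ edges T₂
    onlyCommon : ∀ {e} → e ∈ edges T₁ → e ∈ edges T₂ → (e ≡ e₁) ⊎ (e ≡ e₂)
    e₁∈C : EdgeOfC4 a b c d e₁
    e₂∈C : EdgeOfC4 a b c d e₂

-- Every edge of G lies in T₁ or T₂: each spanning tree has at least n − 1 edges, the two
-- share at most two, and G has only 2n − 4.  Minimum degree: the first edges of walks leaving v
-- in T₁ and in T₂ reach two distinct neighbours, unless they are the same shared edge, which lies
-- on the central cycle, where v has two neighbours anyway.  Maximum degree: a vertex of the cycle
-- misses its opposite vertex.  A vertex v adjacent to all of a, b, c, d would form a wheel whose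
-- eight edges are split between the forests T₁ and T₂ with two rim edges in both; a shared rim
-- edge xy forces the spokes vx and vy into different forests, and then one of the forests
-- contains a triangle, square or pentagon through v.

module Submission where

open import Defs
open import Data.Nat using (ℕ; zero; suc; _+_; _*_; _∸_; _≤_; _<_; z≤n; s≤s)
open import Data.Nat.Properties
open import Data.Fin as Fin using (Fin)
open import Data.Empty using (⊥; ⊥-elim)
open import Data.Product as Product using (∃-syntax; _×_; _,_; proj₁; proj₂)
open import Data.Sum as Sum using (_⊎_; inj₁; inj₂; swap)
open import Data.List using (List; []; _∷_; _++_; length; filter; map; allFin)
open import Data.List.Properties using (length-++; length-++-sucʳ; length-map; length-tabulate)
open import Data.List.Membership.Propositional using (_∈_; _∉_)
open import Data.List.Membership.Propositional.Properties
  using (∈-∃++; ∈-++⁻; ∈-++⁺ˡ; ∈-++⁺ʳ; ∈-allFin; ∈-filter⁺; ∈-filter⁻; ∈-map⁺; ∈-map⁻)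
open import Data.List.Relation.Binary.Subset.Propositional using (_⊆_)
open import Data.List.Relation.Binary.Subset.Propositional.Properties using (⊆-refl; ⊆-trans)
open import Data.List.Relation.Unary.Any using (here; there)
open import Data.List.Relation.Unary.All as All using (All; []; _∷_)
import Data.List.Relation.Unary.All.Properties as All
open import Data.List.Relation.Unary.AllPairs using ([]; _∷_)
open import Data.List.Relation.Unary.Unique.Propositional using (Unique)
import Data.List.Relation.Unary.Unique.Propositional.Properties as Unique
open import Relation.Binary.Definitions using (DecidableEquality)
open import Function using (_∘_)
open import Relation.Binary.PropositionalEquality using (_≡_; _≢_; refl; sym; trans; cong; subst; ≢-sym)
open import Relation.Nullary using (¬_; Dec; yes; no; contradiction)
open import Relation.Nullary.Decidable using (_⊎-dec_)
open import Data.Product.Properties using (≡-dec)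
open import Relation.Unary using (Pred; Decidable)
open import Relation.Unary.Properties using (∁?)

module _ {A : Set} where

  unique⊆⇒length≤ : {xs ys : List A} → Unique xs → xs ⊆ ys → length xs ≤ length ys
  unique⊆⇒length≤ {[]} _ _ = z≤n
  unique⊆⇒length≤ {x ∷ xs} (x∉xs ∷ xs!) x∷xs⊆ys
    with ys₁ , ys₂ , refl ← ∈-∃++ (x∷xs⊆ys (here refl)) =
    subst (suc (length xs) ≤_) (sym (length-++-sucʳ ys₁ x ys₂)) (s≤s (unique⊆⇒length≤ xs! xs⊆ys₁++ys₂))
    where
    xs⊆ys₁++ys₂ : xs ⊆ ys₁ ++ ys₂
    xs⊆ys₁++ys₂ y∈xs with ∈-++⁻ ys₁ (x∷xs⊆ys (there y∈xs))
    ... | inj₁ y∈ys₁         = ∈-++⁺ˡ y∈ys₁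
    ... | inj₂ (here refl)   = contradiction refl (All.lookup x∉xs y∈xs)
    ... | inj₂ (there y∈ys₂) = ∈-++⁺ʳ ys₁ y∈ys₂

  length-filter+∁ : ∀ {ℓ} {P : Pred A ℓ} (P? : Decidable P) (xs : List A) →
                    length (filter P? xs) + length (filter (∁? P?) xs) ≡ length xs
  length-filter+∁ P? [] = refl
  length-filter+∁ P? (x ∷ xs) with P? x
  ... | yes _ = cong suc (length-filter+∁ P? xs)
  ... | no _  = trans (+-suc _ _) (cong suc (length-filter+∁ P? xs))

  unique-map⁺ : ∀ {B : Set} (f : A → B) {xs : List A} →
                (∀ {x y} → x ∈ xs → y ∈ xs → f x ≡ f y → x ≡ y) → Unique xs → Unique (map f xs)
  unique-map⁺ f {[]} _ [] = []
  unique-map⁺ f {x ∷ xs} f-inj (x∉xs ∷ xs!) =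
    All.map⁺ (All.tabulate λ y∈xs fx≡fy → All.lookup x∉xs y∈xs (f-inj (here refl) (there y∈xs) fx≡fy))
    ∷ unique-map⁺ f (λ x∈xs y∈xs → f-inj (there x∈xs) (there y∈xs)) xs!

unique⇒length≤ : ∀ {n} {xs : List (Fin n)} → Unique xs → length xs ≤ n
unique⇒length≤ {n} {xs} xs! =
  subst (length xs ≤_) (length-tabulate {n = n} (λ i → i)) (unique⊆⇒length≤ xs! (λ {x} _ → ∈-allFin x))

module _ {A : Set} (_≟_ : DecidableEquality A) where
  open import Data.List.Membership.DecPropositional _≟_ using (_∈?_; _∉?_)

  long-sublists-cover : {xs ys zs : List A} → Unique xs → Unique ys → xs ⊆ zs → ys ⊆ zs →
                        length zs + length (filter (_∈? xs) ys) ≤ length xs + length ys →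
                        ∀ {z} → z ∈ zs → z ∈ xs ⊎ z ∈ ys
  long-sublists-cover {xs} {ys} {zs} xs! ys! xs⊆zs ys⊆zs long {z} z∈zs with z ∈? xs | z ∈? ys
  ... | yes z∈xs | _        = inj₁ z∈xs
  ... | no _     | yes z∈ys = inj₂ z∈ys
  ... | no z∉xs  | no z∉ys  = contradiction long (<⇒≱ short)
    where
    common new : List A
    common = filter (_∈? xs) ys
    new    = filter (_∉? xs) ys

    ∈-new⁻ : ∀ {w} → w ∈ new → w ∈ ys × w ∉ xs
    ∈-new⁻ = ∈-filter⁻ (_∉? xs) {xs = ys}

    z∉xs++new : ∀ {w} → w ∈ xs ++ new → z ≢ w
    z∉xs++new w∈ refl with ∈-++⁻ xs w∈
    ... | inj₁ z∈xs  = z∉xs z∈xs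
    ... | inj₂ z∈new = z∉ys (proj₁ (∈-new⁻ z∈new))

    z∷xs++new-unique : Unique (z ∷ xs ++ new)
    z∷xs++new-unique = All.tabulate z∉xs++new
                     ∷ Unique.++⁺ xs! (Unique.filter⁺ (_∉? xs) ys!) (λ (w∈xs , w∈new) → proj₂ (∈-new⁻ w∈new) w∈xs)

    z∷xs++new⊆zs : z ∷ xs ++ new ⊆ zs
    z∷xs++new⊆zs (here refl) = z∈zs
    z∷xs++new⊆zs (there w∈) with ∈-++⁻ xs w∈
    ... | inj₁ w∈xs  = xs⊆zs w∈xs
    ... | inj₂ w∈new = ys⊆zs (proj₁ (∈-new⁻ w∈new))

    short : length xs + length ys < length zs + length common
    short = begin-strict
      length xs + length ys                     ≡⟨ cong (length xs +_) (sym (length-filter+∁ (_∈? xs) ys)) ⟩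
      length xs + (length common + length new)  ≡⟨ cong (length xs +_) (+-comm (length common) (length new)) ⟩
      length xs + (length new + length common)  ≡⟨ sym (+-assoc (length xs) (length new) (length common)) ⟩
      length xs + length new + length common    <⟨ +-monoˡ-< (length common) xs++new-shorter ⟩
      length zs + length common                 ∎
      where
      open ≤-Reasoning
      xs++new-shorter : length xs + length new < length zs
      xs++new-shorter = subst (_≤ length zs) (cong suc (length-++ xs))
                              (unique⊆⇒length≤ z∷xs++new-unique z∷xs++new⊆zs)

_≟ₑ_ : ∀ {n} → DecidableEquality (Edge n)
_≟ₑ_ = ≡-dec Fin._≟_ Fin._≟_

module _ {n} (F : EdgeSet n) where

  Adj⇒≢ : ∀ {x y} → Adj F x y → x ≢ y
  Adj⇒≢ (inj₁ xx∈F) refl = <-irrefl refl (All.lookup (normalised F) xx∈F)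
  Adj⇒≢ (inj₂ xx∈F) refl = <-irrefl refl (All.lookup (normalised F) xx∈F)

  Joins⇒Adj : ∀ {e x y} → e ∈ edges F → Joins e x y → Adj F x y
  Joins⇒Adj e∈F (inj₁ (refl , refl)) = inj₁ e∈F
  Joins⇒Adj e∈F (inj₂ (refl , refl)) = inj₂ e∈F

  Adj⇒Joins : ∀ {x y} → Adj F x y → ∃[ e ] e ∈ edges F × Joins e x y
  Adj⇒Joins (inj₁ xy∈F) = _ , xy∈F , inj₁ (refl , refl)
  Adj⇒Joins (inj₂ yx∈F) = _ , yx∈F , inj₂ (refl , refl)

  Adj-mono : ∀ {G x y} → F ⊆E G → Adj F x y → Adj G x y
  Adj-mono F⊆G = Sum.map F⊆G F⊆G

  walk⇒neighbour : ∀ {v w} → v ≢ w → Walk F v w → ∃[ x ] Adj F v x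
  walk⇒neighbour v≢w here          = contradiction refl v≢w
  walk⇒neighbour _   (step vx _) = _ , vx

Adj? : ∀ {n} (F : EdgeSet n) x y → Dec (Adj F x y)
Adj? F x y = ((x , y) ∈? edges F) ⊎-dec ((y , x) ∈? edges F)
  where open import Data.List.Membership.DecPropositional _≟ₑ_ using (_∈?_)

Joins-unique : ∀ {n} {e e′ : Edge n} {x y} → Normalised e → Normalised e′ → Joins e x y → Joins e′ x y → e ≡ e′
Joins-unique _   _   (inj₁ (refl , refl)) (inj₁ (refl , refl)) = refl
Joins-unique _   _   (inj₂ (refl , refl)) (inj₂ (refl , refl)) = refl
Joins-unique x<y y<x (inj₁ (refl , refl)) (inj₂ (refl , refl)) = contradiction x<y (<⇒≯ y<x)
Joins-unique y<x x<y (inj₂ (refl , refl)) (inj₁ (refl , refl)) = contradiction x<y (<⇒≯ y<x)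

Joins-functional : ∀ {n} {e : Edge n} {v x y} → Joins e v x → Joins e v y → x ≡ y
Joins-functional (inj₁ (refl , refl)) (inj₁ (refl , refl)) = refl
Joins-functional (inj₁ (refl , refl)) (inj₂ (x≡y , refl)) = x≡y
Joins-functional (inj₂ (refl , y≡x)) (inj₁ (refl , refl)) = sym y≡x
Joins-functional (inj₂ (refl , refl)) (inj₂ (refl , refl)) = refl

Incident : ∀ {n} → Fin n → Edge n → Set
Incident v e = proj₁ e ≡ v ⊎ proj₂ e ≡ v

incident? : ∀ {n} (v : Fin n) → Decidable (Incident v)
incident? v e = (proj₁ e Fin.≟ v) ⊎-dec (proj₂ e Fin.≟ v)

Joins⇒Incident : ∀ {n} {e : Edge n} {v x} → Joins e v x → Incident v e
Joins⇒Incident (inj₁ (v≡ , _)) = inj₁ v≡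
Joins⇒Incident (inj₂ (_ , v≡)) = inj₂ v≡

-- Only meaningful when e is incident with v.
other : ∀ {n} → Fin n → Edge n → Fin n
other v (x , y) with x Fin.≟ v
... | yes _ = y
... | no _  = x

Joins-other : ∀ {n} {v : Fin n} {e} → Incident v e → Joins e v (other v e)
Joins-other {v = v} {x , y} incident with x Fin.≟ v | incident
... | yes refl | _         = inj₁ (refl , refl)
... | no x≢v   | inj₁ x≡v  = contradiction x≡v x≢v
... | no _     | inj₂ refl = inj₂ (refl , refl)

module _ {n} (G : Graph n) (v : Fin n) where

  incident-edges : List (Edge n)
  incident-edges = filter (incident? v) (edges G)

  neighbours : List (Fin n)
  neighbours = map (other v) incident-edges

  length-neighbours : length neighbours ≡ degree G v
  length-neighbours = length-map (other v) incident-edges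

  ∈-neighbours⁻ : ∀ {w} → w ∈ neighbours → Adj G v w
  ∈-neighbours⁻ w∈ with e , e∈ , refl ← ∈-map⁻ (other v) w∈ =
    let e∈G , incident = ∈-filter⁻ (incident? v) {xs = edges G} e∈ in
    Joins⇒Adj G e∈G (Joins-other incident)

  ∈-neighbours⁺ : ∀ {w} → Adj G v w → w ∈ neighbours
  ∈-neighbours⁺ vw with e , e∈G , joins ← Adj⇒Joins G vw =
    subst (_∈ neighbours) (Joins-functional (Joins-other (Joins⇒Incident joins)) joins)
          (∈-map⁺ (other v) (∈-filter⁺ (incident? v) e∈G (Joins⇒Incident joins)))

  neighbours-unique : Unique neighbours
  neighbours-unique = unique-map⁺ (other v) other-injective (Unique.filter⁺ (incident? v) (unique G))
    where
    other-injective : ∀ {e e′} → e ∈ incident-edges → e′ ∈ incident-edges → other v e ≡ other v e′ → e ≡ e′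
    other-injective e∈ e′∈ same-other
      with e∈G , incident ← ∈-filter⁻ (incident? v) {xs = edges G} e∈
         | e′∈G , incident′ ← ∈-filter⁻ (incident? v) {xs = edges G} e′∈ =
      Joins-unique (All.lookup (normalised G) e∈G) (All.lookup (normalised G) e′∈G)
                   (Joins-other incident) (subst (Joins _ v) (sym same-other) (Joins-other incident′))

  two-neighbours⇒2≤degree : ∀ {x y} → x ≢ y → Adj G v x → Adj G v y → 2 ≤ degree G v
  two-neighbours⇒2≤degree x≢y vx vy =
    subst (2 ≤_) length-neighbours (unique⊆⇒length≤ ((x≢y ∷ []) ∷ [] ∷ []) xy⊆neighbours)
    where
    xy⊆neighbours : _ ∷ _ ∷ [] ⊆ neighbours
    xy⊆neighbours (here refl)         = ∈-neighbours⁺ vx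
    xy⊆neighbours (there (here refl)) = ∈-neighbours⁺ vy

  non-neighbour⇒degree≤n∸2 : ∀ {u} → u ≢ v → ¬ Adj G v u → degree G v ≤ n ∸ 2
  non-neighbour⇒degree≤n∸2 {u} u≢v ¬vu = subst (_≤ n ∸ 2) length-neighbours
    (m+n≤o⇒m≤o∸n (length neighbours) (subst (_≤ n) (+-comm 2 _) (unique⇒length≤ u∷v∷neighbours-unique)))
    where
    u∷v∷neighbours-unique : Unique (u ∷ v ∷ neighbours)
    u∷v∷neighbours-unique =
      (u≢v ∷ All.tabulate (λ w∈ u≡w → ¬vu (subst (Adj G v) (sym u≡w) (∈-neighbours⁻ w∈))))
      ∷ All.tabulate (λ w∈ → Adj⇒≢ G (∈-neighbours⁻ w∈))
      ∷ neighbours-unique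

module Exploration {n} (F : EdgeSet n) where
  open import Data.List.Membership.DecPropositional (Fin._≟_ {n}) using (_∈?_)

  record Explored : Set where
    field
      reached        : List (Fin n)
      used           : List (Edge n)
      used-unique    : Unique used
      used⊆F         : used ⊆ edges F
      length-reached : length reached ≡ suc (length used)
      used-within    : ∀ {e} → e ∈ used → proj₁ e ∈ reached × proj₂ e ∈ reached
  open Explored public

  _⊑_ : Explored → Explored → Set
  S ⊑ S′ = reached S ⊆ reached S′

  root : Fin n → Explored
  root r = record
    { reached = r ∷ [] ; used = [] ; used-unique = [] ; used⊆F = λ ()
    ; length-reached = refl ; used-within = λ () }

  extend : (S : Explored) {x y : Fin n} {e : Edge n} →
           x ∈ reached S → y ∉ reached S → e ∈ edges F → Joins e x y → Explored
  extend S {x} {y} {e} x∈S y∉S e∈F joins = record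
    { reached        = y ∷ reached S
    ; used           = e ∷ used S
    ; used-unique    = All.tabulate e-new ∷ used-unique S
    ; used⊆F         = λ { (here refl) → e∈F ; (there e′∈) → used⊆F S e′∈ }
    ; length-reached = cong suc (length-reached S)
    ; used-within    = λ { (here refl) → ends-within x∈S joins
                         ; (there e′∈) → Product.map there there (used-within S e′∈) }
    }
    where
    e-new : ∀ {e′} → e′ ∈ used S → e ≢ e′
    e-new e′∈ refl with used-within S e′∈ | Joins⇒Incident (swap joins)
    ... | e₁∈S , _ | inj₁ e₁≡y = y∉S (subst (_∈ reached S) e₁≡y e₁∈S)
    ... | _ , e₂∈S | inj₂ e₂≡y = y∉S (subst (_∈ reached S) e₂≡y e₂∈S)

    ends-within : ∀ {e x y} → x ∈ reached S → Joins e x y → proj₁ e ∈ y ∷ reached S × proj₂ e ∈ y ∷ reached S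
    ends-within x∈S (inj₁ (refl , refl)) = there x∈S , here refl
    ends-within x∈S (inj₂ (refl , refl)) = here refl , there x∈S

  explore-edge : (S : Explored) {x y : Fin n} → x ∈ reached S → Adj F x y → ∃[ S′ ] S ⊑ S′ × y ∈ reached S′
  explore-edge S {y = y} x∈S xy with y ∈? reached S
  ... | yes y∈S = S , ⊆-refl , y∈S
  ... | no y∉S  = let _ , e∈F , joins = Adj⇒Joins F xy in extend S x∈S y∉S e∈F joins , there , here refl

  explore-walk : (S : Explored) {x y : Fin n} → x ∈ reached S → Walk F x y → ∃[ S′ ] S ⊑ S′ × y ∈ reached S′
  explore-walk S x∈S here = S , ⊆-refl , x∈S
  explore-walk S x∈S (step xz walk)
    with S₁ , S⊑S₁ , z∈S₁ ← explore-edge S x∈S xz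
    with S₂ , S₁⊑S₂ , y∈S₂ ← explore-walk S₁ z∈S₁ walk
    = S₂ , ⊆-trans S⊑S₁ S₁⊑S₂ , y∈S₂

  explore-all : Connected F → (S : Explored) {r : Fin n} → r ∈ reached S →
                (vs : List (Fin n)) → ∃[ S′ ] S ⊑ S′ × vs ⊆ reached S′
  explore-all connected S r∈S [] = S , ⊆-refl , λ ()
  explore-all connected S {r} r∈S (v ∷ vs)
    with S₁ , S⊑S₁ , vs⊆S₁ ← explore-all connected S r∈S vs
    with S₂ , S₁⊑S₂ , v∈S₂ ← explore-walk S₁ (S⊑S₁ r∈S) (connected r v)
    = S₂ , ⊆-trans S⊑S₁ S₁⊑S₂ , λ { (here refl) → v∈S₂ ; (there w∈) → S₁⊑S₂ (vs⊆S₁ w∈) }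

connected⇒n≤1+numEdges : ∀ {n} (F : EdgeSet n) → Connected F → n ≤ suc (numEdges F)
connected⇒n≤1+numEdges {zero} F _ = z≤n
connected⇒n≤1+numEdges {suc m} F connected =
  let S , _ , allFin⊆S = explore-all connected (root Fin.zero) (here refl) (allFin (suc m)) in begin
    suc m                    ≡⟨ sym (length-tabulate {n = suc m} (λ i → i)) ⟩
    length (allFin (suc m))  ≤⟨ unique⊆⇒length≤ (Unique.allFin⁺ (suc m)) allFin⊆S ⟩
    length (reached S)       ≡⟨ length-reached S ⟩
    suc (length (used S))    ≤⟨ s≤s (unique⊆⇒length≤ (used-unique S) (used⊆F S)) ⟩
    suc (numEdges F)         ∎
  where
  open Exploration F
  open ≤-Reasoning

module _ {n} {F : EdgeSet n} (acyclic : Acyclic F) where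

  no-triangle : ∀ {x y z} → Adj F x y → Adj F y z → Adj F z x → ⊥
  no-triangle xy yz zx = acyclic record
    { first = _ ; rest = _ ∷ [] ; last = _ ; long = s≤s z≤n
    ; path     = cons xy (cons yz one)
    ; distinct = (Adj⇒≢ F xy ∷ ≢-sym (Adj⇒≢ F zx) ∷ []) ∷ (Adj⇒≢ F yz ∷ []) ∷ [] ∷ []
    ; closes   = zx
    }

  no-square : ∀ {x y z w} → x ≢ z → y ≢ w →
              Adj F x y → Adj F y z → Adj F z w → Adj F w x → ⊥
  no-square x≢z y≢w xy yz zw wx = acyclic record
    { first = _ ; rest = _ ∷ _ ∷ [] ; last = _ ; long = s≤s z≤n
    ; path     = cons xy (cons yz (cons zw one))
    ; distinct = (Adj⇒≢ F xy ∷ x≢z ∷ ≢-sym (Adj⇒≢ F wx) ∷ [])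
               ∷ (Adj⇒≢ F yz ∷ y≢w ∷ []) ∷ (Adj⇒≢ F zw ∷ []) ∷ [] ∷ []
    ; closes   = wx
    }

  no-pentagon : ∀ {x y z w u} → x ≢ z → x ≢ w → y ≢ w → y ≢ u → z ≢ u →
                Adj F x y → Adj F y z → Adj F z w → Adj F w u → Adj F u x → ⊥
  no-pentagon x≢z x≢w y≢w y≢u z≢u xy yz zw wu ux = acyclic record
    { first = _ ; rest = _ ∷ _ ∷ _ ∷ [] ; last = _ ; long = s≤s z≤n
    ; path     = cons xy (cons yz (cons zw (cons wu one)))
    ; distinct = (Adj⇒≢ F xy ∷ x≢z ∷ x≢w ∷ ≢-sym (Adj⇒≢ F ux) ∷ [])
               ∷ (Adj⇒≢ F yz ∷ y≢w ∷ y≢u ∷ []) ∷ (Adj⇒≢ F zw ∷ z≢u ∷ []) ∷ (Adj⇒≢ F wu ∷ []) ∷ [] ∷ []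
    ; closes   = ux
    }

pattern on-ab j = inj₁ j
pattern on-bc j = inj₂ (inj₁ j)
pattern on-cd j = inj₂ (inj₂ (inj₁ j))
pattern on-da j = inj₂ (inj₂ (inj₂ j))

Joins-endpoint : ∀ {n} {e : Edge n} {v x p q} → Joins e v x → Joins e p q → v ∈ p ∷ q ∷ []
Joins-endpoint (inj₁ (refl , _)) (inj₁ (refl , _)) = here refl
Joins-endpoint (inj₁ (refl , _)) (inj₂ (refl , _)) = there (here refl)
Joins-endpoint (inj₂ (_ , refl)) (inj₁ (_ , refl)) = there (here refl)
Joins-endpoint (inj₂ (_ , refl)) (inj₂ (_ , refl)) = here refl

Joins-EdgeOfC4 : ∀ {n} {e : Edge n} {v x a b c d} → Joins e v x → EdgeOfC4 a b c d e → v ∈ a ∷ b ∷ c ∷ d ∷ []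
Joins-EdgeOfC4 j (on-ab j′) = ∈-++⁺ˡ (Joins-endpoint j j′)
Joins-EdgeOfC4 j (on-bc j′) = there (∈-++⁺ˡ (Joins-endpoint j j′))
Joins-EdgeOfC4 j (on-cd j′) = there (there (Joins-endpoint j j′))
Joins-EdgeOfC4 j (on-da j′) with Joins-endpoint j j′
... | here refl         = there (there (there (here refl)))
... | there (here refl) = here refl

module TwoForests {n} {F F′ : EdgeSet n} (acyclic : Acyclic F) (acyclic′ : Acyclic F′) where

  Covered Shared : Fin n → Fin n → Set
  Covered x y = Adj F x y ⊎ Adj F′ x y
  Shared  x y = Adj F x y × Adj F′ x y

  Covered⇒≢ : ∀ {x y} → Covered x y → x ≢ y
  Covered⇒≢ (inj₁ xy) = Adj⇒≢ F xy
  Covered⇒≢ (inj₂ xy) = Adj⇒≢ F′ xy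

  -- Distinctness of the other pairs of vertices follows from their adjacency.
  record Wheel (v a b c d : Fin n) : Set where
    field
      spoke-a : Covered v a
      spoke-b : Covered v b
      spoke-c : Covered v c
      spoke-d : Covered v d
      rim-ab  : Covered a b
      rim-bc  : Covered b c
      rim-cd  : Covered c d
      rim-da  : Covered d a
      a≢c     : a ≢ c
      b≢d     : b ≢ d
  open Wheel

  rotate : ∀ {v a b c d} → Wheel v a b c d → Wheel v b c d a
  rotate W = record
    { spoke-a = spoke-b W ; spoke-b = spoke-c W ; spoke-c = spoke-d W ; spoke-d = spoke-a W
    ; rim-ab  = rim-bc W  ; rim-bc  = rim-cd W  ; rim-cd  = rim-da W  ; rim-da  = rim-ab W
    ; a≢c     = b≢d W     ; b≢d     = ≢-sym (a≢c W)
    }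

  adjacent-shared : ∀ {v a b c d} → Wheel v a b c d → Shared a b → Shared b c → ⊥
  adjacent-shared W (ab , ab′) (bc , bc′) with spoke-a W | spoke-b W | spoke-c W
  ... | inj₁ va | inj₁ vb | _       = no-triangle acyclic  va ab  (swap vb)
  ... | inj₂ va | inj₂ vb | _       = no-triangle acyclic′ va ab′ (swap vb)
  ... | _       | inj₁ vb | inj₁ vc = no-triangle acyclic  vb bc  (swap vc)
  ... | _       | inj₂ vb | inj₂ vc = no-triangle acyclic′ vb bc′ (swap vc)
  ... | inj₁ va | inj₂ vb | inj₁ vc = no-square acyclic  (Adj⇒≢ F′ vb) (a≢c W) va ab  bc  (swap vc)
  ... | inj₂ va | inj₁ vb | inj₂ vc = no-square acyclic′ (Adj⇒≢ F vb) (a≢c W) va ab′ bc′ (swap vc)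

  opposite-shared : ∀ {v a b c d} → Wheel v a b c d → Shared a b → Shared c d → ⊥
  opposite-shared W (ab , ab′) (cd , cd′) with spoke-a W | spoke-b W | spoke-c W | spoke-d W | rim-bc W
  ... | inj₁ va | inj₁ vb | _       | _       | _       = no-triangle acyclic  va ab  (swap vb)
  ... | inj₂ va | inj₂ vb | _       | _       | _       = no-triangle acyclic′ va ab′ (swap vb)
  ... | _       | _       | inj₁ vc | inj₁ vd | _       = no-triangle acyclic  vc cd  (swap vd)
  ... | _       | _       | inj₂ vc | inj₂ vd | _       = no-triangle acyclic′ vc cd′ (swap vd)
  ... | inj₁ va | inj₂ vb | inj₁ vc | inj₂ vd | inj₁ bc = no-square acyclic  (Adj⇒≢ F′ vb) (a≢c W) va ab  bc  (swap vc)
  ... | inj₁ va | inj₂ vb | inj₁ vc | inj₂ vd | inj₂ bc = no-square acyclic′ (Adj⇒≢ F  vc) (b≢d W) vb bc  cd′ (swap vd)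
  ... | inj₂ va | inj₁ vb | inj₂ vc | inj₁ vd | inj₂ bc = no-square acyclic′ (Adj⇒≢ F  vb) (a≢c W) va ab′ bc  (swap vc)
  ... | inj₂ va | inj₁ vb | inj₂ vc | inj₁ vd | inj₁ bc = no-square acyclic  (Adj⇒≢ F′ vc) (b≢d W) vb bc  cd  (swap vd)
  ... | inj₁ va | inj₂ vb | inj₂ vc | inj₁ vd | inj₂ bc = no-triangle acyclic′ vb bc (swap vc)
  ... | inj₂ va | inj₁ vb | inj₁ vc | inj₂ vd | inj₁ bc = no-triangle acyclic  vb bc (swap vc)
  ... | inj₁ va | inj₂ vb | inj₂ vc | inj₁ vd | inj₁ bc =
    no-pentagon acyclic  (Adj⇒≢ F′ vb) (Adj⇒≢ F′ vc) (a≢c W) (≢-sym (Covered⇒≢ (rim-da W))) (b≢d W)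
                va ab  bc cd  (swap vd)
  ... | inj₂ va | inj₁ vb | inj₁ vc | inj₂ vd | inj₂ bc =
    no-pentagon acyclic′ (Adj⇒≢ F vb) (Adj⇒≢ F vc) (a≢c W) (≢-sym (Covered⇒≢ (rim-da W))) (b≢d W)
                va ab′ bc cd′ (swap vd)

  SharedEdge : Edge n → Set
  SharedEdge e = e ∈ edges F × e ∈ edges F′

  at-most-one-shared-rim-edge : ∀ {v a b c d e e′} → Wheel v a b c d → SharedEdge e → SharedEdge e′ →
                                EdgeOfC4 a b c d e → EdgeOfC4 a b c d e′ → e ≡ e′
  at-most-one-shared-rim-edge {v} {a} {b} {c} {d} {e} {e′} W (e∈F , e∈F′) (e′∈F , e′∈F′) = rim-pair
    where
    s : ∀ {x y} → Joins e x y → Shared x y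
    s j = Joins⇒Adj F e∈F j , Joins⇒Adj F′ e∈F′ j
    s′ : ∀ {x y} → Joins e′ x y → Shared x y
    s′ j = Joins⇒Adj F e′∈F j , Joins⇒Adj F′ e′∈F′ j
    same : ∀ {x y} → Joins e x y → Joins e′ x y → e ≡ e′
    same = Joins-unique (All.lookup (normalised F) e∈F) (All.lookup (normalised F) e′∈F)
    W¹ : Wheel v b c d a
    W¹ = rotate W
    W² : Wheel v c d a b
    W² = rotate W¹
    W³ : Wheel v d a b c
    W³ = rotate W²
    rim-pair : EdgeOfC4 a b c d e → EdgeOfC4 a b c d e′ → e ≡ e′
    rim-pair (on-ab j) (on-ab j′) = same j j′
    rim-pair (on-ab j) (on-bc j′) = ⊥-elim (adjacent-shared W  (s j)   (s′ j′))
    rim-pair (on-ab j) (on-cd j′) = ⊥-elim (opposite-shared W  (s j)   (s′ j′))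
    rim-pair (on-ab j) (on-da j′) = ⊥-elim (adjacent-shared W³ (s′ j′) (s j))
    rim-pair (on-bc j) (on-ab j′) = ⊥-elim (adjacent-shared W  (s′ j′) (s j))
    rim-pair (on-bc j) (on-bc j′) = same j j′
    rim-pair (on-bc j) (on-cd j′) = ⊥-elim (adjacent-shared W¹ (s j)   (s′ j′))
    rim-pair (on-bc j) (on-da j′) = ⊥-elim (opposite-shared W¹ (s j)   (s′ j′))
    rim-pair (on-cd j) (on-ab j′) = ⊥-elim (opposite-shared W  (s′ j′) (s j))
    rim-pair (on-cd j) (on-bc j′) = ⊥-elim (adjacent-shared W¹ (s′ j′) (s j))
    rim-pair (on-cd j) (on-cd j′) = same j j′
    rim-pair (on-cd j) (on-da j′) = ⊥-elim (adjacent-shared W² (s j)   (s′ j′))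
    rim-pair (on-da j) (on-ab j′) = ⊥-elim (adjacent-shared W³ (s j)   (s′ j′))
    rim-pair (on-da j) (on-bc j′) = ⊥-elim (opposite-shared W¹ (s′ j′) (s j))
    rim-pair (on-da j) (on-cd j′) = ⊥-elim (adjacent-shared W² (s′ j′) (s j))
    rim-pair (on-da j) (on-da j′) = same j j′

two-spanning-trees-edge-count : ∀ {n t₁ t₂} → 2 ≤ n → n ≤ suc t₁ → n ≤ suc t₂ → 2 * n ∸ 4 + 2 ≤ t₁ + t₂
two-spanning-trees-edge-count {n} {t₁} {t₂} 2≤n n≤1+t₁ n≤1+t₂ = begin
  2 * n ∸ 4 + 2     ≡⟨ +-comm (2 * n ∸ 4) 2 ⟩
  2 + (2 * n ∸ 4)   ≡⟨ sym (+-∸-assoc 2 (*-monoʳ-≤ 2 2≤n)) ⟩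
  2 * n ∸ 2         ≤⟨ m≤n+o⇒m∸n≤o (2 * n) 2 2n≤2+t₁+t₂ ⟩
  t₁ + t₂           ∎
  where
  open ≤-Reasoning
  2n≤2+t₁+t₂ : 2 * n ≤ 2 + (t₁ + t₂)
  2n≤2+t₁+t₂ = begin
    2 * n             ≡⟨ cong (n +_) (+-identityʳ n) ⟩
    n + n             ≤⟨ +-mono-≤ n≤1+t₁ n≤1+t₂ ⟩
    suc t₁ + suc t₂   ≡⟨ cong suc (+-suc t₁ t₂) ⟩
    2 + (t₁ + t₂)     ∎

module Pivotable {n} {G : Graph n} (P : C4Pivotable G) where
  open C4Pivotable P
  open InducedC4 central
  open import Data.List.Membership.DecPropositional (_≟ₑ_ {n}) using () renaming (_∈?_ to _∈ₑ?_)
  open import Data.List.Membership.DecPropositional (Fin._≟_ {n}) using (_∈?_; find)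

  C4 : List (Fin n)
  C4 = a ∷ b ∷ c ∷ d ∷ []

  T₁-connected : Connected T₁
  T₁-connected = proj₁ (proj₂ span₁)
  T₂-connected : Connected T₂
  T₂-connected = proj₁ (proj₂ span₂)

  edges-covered : ∀ {e} → e ∈ edges G → e ∈ edges T₁ ⊎ e ∈ edges T₂
  edges-covered = long-sublists-cover _≟ₑ_ (unique T₁) (unique T₂) (proj₁ span₁) (proj₁ span₂) (begin
      numEdges G + length common      ≡⟨ cong (_+ length common) edgeCount ⟩
      2 * n ∸ 4 + length common       ≤⟨ +-monoʳ-≤ (2 * n ∸ 4) common≤2 ⟩
      2 * n ∸ 4 + 2                   ≤⟨ two-spanning-trees-edge-count 2≤n (connected⇒n≤1+numEdges T₁ T₁-connected)
                                                                            (connected⇒n≤1+numEdges T₂ T₂-connected) ⟩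
      numEdges T₁ + numEdges T₂       ∎)
    where
    open ≤-Reasoning
    common : List (Edge n)
    common = filter (_∈ₑ? edges T₁) (edges T₂)
    common≤2 : length common ≤ 2
    common≤2 = unique⊆⇒length≤ (Unique.filter⁺ (_∈ₑ? edges T₁) (unique T₂)) common⊆e₁e₂
      where
      common⊆e₁e₂ : common ⊆ e₁ ∷ e₂ ∷ []
      common⊆e₁e₂ e∈ with e∈T₂ , e∈T₁ ← ∈-filter⁻ (_∈ₑ? edges T₁) {xs = edges T₂} e∈
                    with onlyCommon e∈T₁ e∈T₂
      ... | inj₁ e≡e₁ = here e≡e₁
      ... | inj₂ e≡e₂ = there (here e≡e₂)
    2≤n : 2 ≤ n
    2≤n = unique⇒length≤ ((a≢b ∷ []) ∷ [] ∷ [])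

  covered : ∀ {x y} → Adj G x y → Adj T₁ x y ⊎ Adj T₂ x y
  covered (inj₁ xy∈G) = Sum.map inj₁ inj₁ (edges-covered xy∈G)
  covered (inj₂ yx∈G) = Sum.map inj₂ inj₂ (edges-covered yx∈G)

  C4-neighbours : ∀ {v} → v ∈ C4 → ∃[ x ] ∃[ y ] x ≢ y × Adj G v x × Adj G v y
  C4-neighbours (here refl)                         = b , d , b≢d , ab , swap da
  C4-neighbours (there (here refl))                 = a , c , a≢c , swap ab , bc
  C4-neighbours (there (there (here refl)))         = b , d , b≢d , swap bc , cd
  C4-neighbours (there (there (there (here refl)))) = a , c , a≢c , da , swap cd

  C4-non-neighbour : ∀ {v} → v ∈ C4 → ∃[ u ] u ≢ v × ¬ Adj G v u
  C4-non-neighbour (here refl)                         = c , ≢-sym a≢c , ¬ac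
  C4-non-neighbour (there (here refl))                 = d , ≢-sym b≢d , ¬bd
  C4-non-neighbour (there (there (here refl)))         = a , a≢c , ¬ac ∘ swap
  C4-non-neighbour (there (there (there (here refl)))) = b , b≢d , ¬bd ∘ swap

  common-tree-neighbour : ∀ {v x} → Adj T₁ v x → Adj T₂ v x → v ∈ C4
  common-tree-neighbour vx₁ vx₂
    with e , e∈T₁ , j ← Adj⇒Joins T₁ vx₁ | e′ , e′∈T₂ , j′ ← Adj⇒Joins T₂ vx₂
    with refl ← Joins-unique (All.lookup (normalised T₁) e∈T₁) (All.lookup (normalised T₂) e′∈T₂) j j′
    with onlyCommon e∈T₁ e′∈T₂
  ... | inj₁ refl = Joins-EdgeOfC4 j e₁∈C
  ... | inj₂ refl = Joins-EdgeOfC4 j e₂∈C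

  another-vertex : ∀ v → ∃[ w ] v ≢ w
  another-vertex v with v Fin.≟ a
  ... | yes refl = b , a≢b
  ... | no v≢a   = a , v≢a

  two-neighbours : ∀ v → ∃[ x ] ∃[ y ] x ≢ y × Adj G v x × Adj G v y
  two-neighbours v
    with w , v≢w ← another-vertex v
    with x , vx ← walk⇒neighbour T₁ v≢w (T₁-connected v w)
       | y , vy ← walk⇒neighbour T₂ v≢w (T₂-connected v w)
    with x Fin.≟ y
  ... | no x≢y   = x , y , x≢y , Adj-mono T₁ {G} (proj₁ span₁) vx , Adj-mono T₂ {G} (proj₁ span₂) vy
  ... | yes refl = C4-neighbours (common-tree-neighbour vx vy)

  no-wheel : ∀ {v} → All (Adj G v) C4 → ⊥
  no-wheel {v} (va ∷ vb ∷ vc ∷ vd ∷ []) =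
    e₁≢e₂ (at-most-one-shared-rim-edge wheel (e₁∈T₁ , e₁∈T₂) (e₂∈T₁ , e₂∈T₂) e₁∈C e₂∈C)
    where
    open TwoForests (proj₂ (proj₂ span₁)) (proj₂ (proj₂ span₂))
    wheel : Wheel v a b c d
    wheel = record
      { spoke-a = covered va ; spoke-b = covered vb ; spoke-c = covered vc ; spoke-d = covered vd
      ; rim-ab  = covered ab ; rim-bc  = covered bc ; rim-cd  = covered cd ; rim-da  = covered da
      ; a≢c     = a≢c        ; b≢d     = b≢d
      }

  non-neighbour : ∀ v → ∃[ u ] u ≢ v × ¬ Adj G v u
  non-neighbour v with v ∈? C4
  ... | yes v∈C4 = C4-non-neighbour v∈C4
  ... | no v∉C4 with All.all? (Adj? G v) C4
  ...   | yes spokes = ⊥-elim (no-wheel spokes)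
  ...   | no ¬spokes with u , u∈C4 , ¬vu ← find (All.¬All⇒Any¬ (Adj? G v) C4 ¬spokes)
    = u , (λ { refl → v∉C4 u∈C4 }) , ¬vu

lemma4p2 : (n : ℕ) (G : Graph n) → C4Pivotable G →
           ((v : Fin n) → 2 ≤ degree G v) × ((v : Fin n) → degree G v ≤ n ∸ 2)
lemma4p2 n G P = min-degree , max-degree
  where
  open Pivotable P
  min-degree : (v : Fin n) → 2 ≤ degree G v
  min-degree v = let x , y , x≢y , vx , vy = two-neighbours v in two-neighbours⇒2≤degree G v x≢y vx vy
  max-degree : (v : Fin n) → degree G v ≤ n ∸ 2
  max-degree v = let u , u≢v , ¬vu = non-neighbour v in non-neighbour⇒degree≤n∸2 G v u≢v ¬vu
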